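{- If $m\ge1$ and $G$ is the subdivided star $T_{m+1}$, then $\operatorname{capt}(G,m)=4m-2$.
   Context: All graphs are reflexive. The game of one cop and $m$ robbers: in round $0$ the cop chooses a starting vertex, then the robbers choose starting vertices (players may share vertices). In each round $i\ge1$ the cop moves to an adjacent vertex or stays, then every robber moves to an adjacent vertex or stays. Whenever the cop occupies the same vertex as some robbers, those robbers are captured and leave the game. For a cop-win graph, $\operatorname{capt}(G,m)$ is the smallest $t$ such that the cop has a strategy guaranteeing all $m$ robbers are captured by round $t$ regardless of the robbers' play. The subdivided star $T_n$ is obtained from the star $K_{1,n}$ by adding $n$ new vertices and joining each new vertex to a distinct leaf of the star. -}

module Defs where

open import Level using (0ℓ)
open import Data.Nat using (ℕ; zero; suc; _<_)
open import Data.Unit using (⊤)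
open import Data.Sum using (_⊎_)
open import Data.Fin using (Fin)
import Data.Fin.Properties as FinP
open import Data.Maybe using (Maybe; just; nothing)
open import Data.Vec using (Vec; map)
open import Data.Vec.Relation.Unary.All using (All)
open import Data.Vec.Relation.Binary.Pointwise.Inductive using (Pointwise)
open import Data.Product using (Σ; _×_; _,_)
open import Data.Empty using (⊥)
open import Relation.Nullary using (Dec; yes; no; ¬_)
open import Relation.Binary.PropositionalEquality using (_≡_; refl; cong)

record Graph : Set₁ where
  field
    V      : Set
    _≟_    : (x y : V) → Dec (x ≡ y)
    Adj    : V → V → Set
    refl-adj : ∀ x → Adj x x
    sym-adj  : ∀ {x y} → Adj x y → Adj y x

-- The game of one cop and m robbers.
-- A robber configuration is a vector of length m; 'nothing' marks a
-- captured robber (who has left the game), 'just v' a robber at v.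

module Game (G : Graph) where
  open Graph G

  Robbers : ℕ → Set
  Robbers m = Vec (Maybe V) m

  captureOne : V → Maybe V → Maybe V
  captureOne c nothing = nothing
  captureOne c (just r) with c ≟ r
  ... | yes _ = nothing
  ... | no  _ = just r

  capture : ∀ {m} → V → Robbers m → Robbers m
  capture c = map (captureOne c)

  Captured : Maybe V → Set
  Captured nothing  = ⊤
  Captured (just _) = ⊥

  AllCaptured : ∀ {m} → Robbers m → Set
  AllCaptured = All Captured

  data RMove : Maybe V → Maybe V → Set where
    gone : RMove nothing nothing
    step : ∀ {u v} → Adj u v → RMove (just u) (just v)

  RobberMoves : ∀ {m} → Robbers m → Robbers m → Set
  RobberMoves = Pointwise RMove

  -- Win k c rs : the position at the end of a round, cop at c, robbers rs
  -- (captures already performed); the cop can guarantee that all robbers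
  -- are captured within at most k further rounds.
  Win : ℕ → ∀ {m} → V → Robbers m → Set
  Win zero    c rs = AllCaptured rs
  Win (suc k) c rs =
    AllCaptured rs ⊎
    Σ V (λ c′ → Adj c c′ ×
      ((rs′ : _) → RobberMoves (capture c′ rs) rs′ →
        Win k c′ (capture c′ rs′)))

  -- The cop has a strategy guaranteeing capture of all m robbers by
  -- round t: round 0 the cop picks c, then the robbers pick their
  -- starting vertices (sharing allowed), captures occur, then rounds 1..t.
  CaptureBy : ℕ → ℕ → Set
  CaptureBy m t =
    Σ V (λ c → (rs : Vec V m) → Win t c (capture c (map just rs)))

  CaptEq : ℕ → ℕ → Set
  CaptEq m t = CaptureBy m t × (∀ t′ → t′ < t → ¬ CaptureBy m t′)

-- The subdivided star T_n: centre, n star leaves ('mid i') and n new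
-- vertices ('outer i'), with outer i joined to mid i.

data TV (n : ℕ) : Set where
  centre : TV n
  mid    : Fin n → TV n
  outer  : Fin n → TV n

data TAdj {n : ℕ} : TV n → TV n → Set where
  loop  : ∀ {x} → TAdj x x
  c-m   : ∀ i → TAdj centre (mid i)
  m-c   : ∀ i → TAdj (mid i) centre
  m-o   : ∀ i → TAdj (mid i) (outer i)
  o-m   : ∀ i → TAdj (outer i) (mid i)

TAdj-sym : ∀ {n} {x y : TV n} → TAdj x y → TAdj y x
TAdj-sym loop    = loop
TAdj-sym (c-m i) = m-c i
TAdj-sym (m-c i) = c-m i
TAdj-sym (m-o i) = o-m i
TAdj-sym (o-m i) = m-o i

_≟T_ : ∀ {n} (x y : TV n) → Dec (x ≡ y)
centre ≟T centre = yes refl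
centre ≟T mid _ = no λ ()
centre ≟T outer _ = no λ ()
mid _ ≟T centre = no λ ()
mid i ≟T mid j with i FinP.≟ j
... | yes refl = yes refl
... | no ne = no λ { refl → ne refl }
mid _ ≟T outer _ = no λ ()
outer _ ≟T centre = no λ ()
outer _ ≟T mid _ = no λ ()
outer i ≟T outer j with i FinP.≟ j
... | yes refl = yes refl
... | no ne = no λ { refl → ne refl }

T : ℕ → Graph
T n = record
  { V = TV n ; _≟_ = _≟T_ ; Adj = TAdj
  ; refl-adj = λ _ → loop ; sym-adj = TAdj-sym }

capt= : Graph → ℕ → ℕ → Set
capt= G m t = Game.CaptEq G m t

module Submission where

-- Upper bound: from the centre the cop walks to the leaf of a branch that still holds a
-- robber and back.  A robber in that branch is trapped between the cop and the leaf, so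
-- every such four-round trip captures a robber, and after the last capture the cop need
-- not return: 4m − 2 rounds.
-- Lower bound: m robbers sit still on the leaves of the m branches avoiding the cop's
-- start.  The length of a shortest walk from the cop that visits every occupied leaf and
-- ends at the centre is at least 4m at the start, drops by at most one per round, and is
-- at most 2 once every robber is caught.

open import Defs
open import Data.Nat using (ℕ; zero; suc; _+_; _*_; _∸_; _≤_; _<_; z≤n; s≤s)
open import Data.Nat.Properties
  using ( ≤-refl; ≤-reflexive; ≤-trans; ≤-pred; ≤⇒≯; n≤1+n; m≤n+m
        ; +-mono-≤; +-monoˡ-≤; +-monoʳ-≤; +-monoʳ-<; +-suc; +-assoc; +-comm; +-identityʳ
        ; *-comm; +-0-commutativeMonoid; module ≤-Reasoning )
open import Algebra.Properties.CommutativeMonoid.Sum +-0-commutativeMonoid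
  using (sum; sum-syntax; sum-remove; sum-cong-≗; sum-replicate-zero)
open import Data.Bool using (if_then_else_)
open import Data.Fin using (Fin; punchIn)
open import Data.Fin.Properties using (punchInᵢ≢i) renaming (_≟_ to _≟ᶠ_)
open import Data.Maybe using (Maybe; just; nothing)
open import Data.Maybe.Properties using (≡-dec)
open import Data.Vec using (Vec; []; _∷_; map; tabulate)
open import Data.Vec.Relation.Unary.All using ([]; _∷_)
open import Data.Vec.Relation.Unary.Any using (Any; here; there)
open import Data.Vec.Relation.Binary.Pointwise.Inductive using ([]; _∷_)
  renaming (refl to Pointwise-refl)
open import Data.Vec.Membership.Propositional using (_∈_; _∉_)
open import Data.Vec.Membership.Propositional.Properties using (∈-map⁺; ∈-tabulate⁺)
open import Data.Product using (∃-syntax; _×_; _,_; map₂)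
open import Data.Sum using (_⊎_; inj₁; inj₂)
import Data.Sum as Sum
open import Data.Unit using (tt)
open import Function using (_∘_)
open import Relation.Nullary using (¬_; yes; no; does; contradiction)
open import Relation.Nullary.Decidable using (dec-true; dec-false)
open import Relation.Binary.PropositionalEquality

∑-mono-≤ : ∀ {n} {f g : Fin n → ℕ} → (∀ i → f i ≤ g i) → sum f ≤ sum g
∑-mono-≤ {zero}  _   = z≤n
∑-mono-≤ {suc n} f≤g = +-mono-≤ (f≤g Fin.zero) (∑-mono-≤ (f≤g ∘ Fin.suc))

∑-replicate : ∀ n k → ∑[ i < n ] k ≡ n * k
∑-replicate zero    k = refl
∑-replicate (suc n) k = cong (k +_) (∑-replicate n k)

module GameProperties (G : Graph) where
  open Graph G
  open Game G

  captureOne-self : ∀ c → captureOne c (just c) ≡ nothing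
  captureOne-self c with c ≟ c
  ... | yes _  = refl
  ... | no c≢c = contradiction refl c≢c

  captureOne-other : ∀ {c v} → c ≢ v → captureOne c (just v) ≡ just v
  captureOne-other {c} {v} c≢v with c ≟ v
  ... | yes c≡v = contradiction c≡v c≢v
  ... | no _    = refl

  captured-stays-captured : ∀ {r r′} → RMove r r′ → r ≡ nothing → r′ ≡ nothing
  captured-stays-captured gone refl = refl

  stay : ∀ {m} (X : Robbers m) → RobberMoves X X
  stay X = Pointwise-refl RMove-refl
    where
    RMove-refl : ∀ {r} → RMove r r
    RMove-refl {nothing} = gone
    RMove-refl {just v}  = step (refl-adj v)

  captured-unoccupied : ∀ {m v} {X : Robbers m} → AllCaptured X → just v ∉ X
  captured-unoccupied (() ∷ _) (here refl)
  captured-unoccupied (_ ∷ done) (there v∈X) = captured-unoccupied done v∈X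

  alive : Maybe V → ℕ
  alive nothing  = 0
  alive (just _) = 1

  remaining : ∀ {m} → Robbers m → ℕ
  remaining []      = 0
  remaining (r ∷ X) = alive r + remaining X

  alive≤1 : ∀ r → alive r ≤ 1
  alive≤1 nothing  = z≤n
  alive≤1 (just _) = ≤-refl

  alive-round : ∀ {c r r′} → RMove (captureOne c r) r′ → alive (captureOne c r′) ≤ alive r
  alive-round {r = nothing} gone = z≤n
  alive-round {r = just _}  _    = alive≤1 _

  remaining-round : ∀ {m c} {X X′ : Robbers m} →
                    RobberMoves (capture c X) X′ → remaining (capture c X′) ≤ remaining X
  remaining-round {X = []}    []       = z≤n
  remaining-round {X = _ ∷ _} (p ∷ ps) = +-mono-≤ (alive-round p) (remaining-round ps)

  remaining-capture : ∀ {m} c (X : Robbers m) → remaining (capture c X) ≤ remaining X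
  remaining-capture c []            = z≤n
  remaining-capture c (nothing ∷ X) = remaining-capture c X
  remaining-capture c (just v ∷ X)  = +-mono-≤ (alive≤1 _) (remaining-capture c X)

  remaining-map-just : ∀ {m} (vs : Vec V m) → remaining (map just vs) ≡ m
  remaining-map-just []       = refl
  remaining-map-just (_ ∷ vs) = cong suc (remaining-map-just vs)

  remaining≤0⇒AllCaptured : ∀ {m} {X : Robbers m} → remaining X ≤ 0 → AllCaptured X
  remaining≤0⇒AllCaptured {X = []}          _ = []
  remaining≤0⇒AllCaptured {X = nothing ∷ X} z = tt ∷ remaining≤0⇒AllCaptured z

  WinsAgainst : ℕ → V → ℕ → Set
  WinsAgainst k c p = ∀ {m} (X : Robbers m) → remaining (capture c X) ≤ p → Win k c (capture c X)

  advance : ∀ {k c c′ p} → Adj c c′ → WinsAgainst k c′ p → WinsAgainst (suc k) c p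
  advance {c′ = c′} adj win X bound =
    inj₂ (c′ , adj , λ X′ moves → win X′ (≤-trans (remaining-round moves) bound))

  module LazyRobbers {m} (Φ : V → Robbers m → ℕ) (d : ℕ)
    (Φ-end     : ∀ c {X} → AllCaptured X → Φ c X ≤ d)
    (Φ-capture : ∀ c X → Φ c X ≤ Φ c (capture c X))
    (Φ-move    : ∀ {c c′} X → Adj c c′ → Φ c X ≤ suc (Φ c′ X)) where

    lazy-robbers-escape : ∀ k c X → k + d < Φ c X → ¬ Win k c X
    lazy-robbers-escape zero    c X d<Φ   done        = ≤⇒≯ (Φ-end c done) d<Φ
    lazy-robbers-escape (suc k) c X k+d<Φ (inj₁ done) =
      ≤⇒≯ (Φ-end c done) (≤-trans (s≤s (m≤n+m d (suc k))) k+d<Φ)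
    lazy-robbers-escape (suc k) c X k+d<Φ (inj₂ (c′ , adj , strategy)) =
      lazy-robbers-escape k c′ (capture c′ (capture c′ X)) bound (strategy (capture c′ X) (stay _))
      where
      bound : k + d < Φ c′ (capture c′ (capture c′ X))
      bound = ≤-trans (≤-pred (≤-trans k+d<Φ (Φ-move X adj)))
                      (≤-trans (Φ-capture c′ X) (Φ-capture c′ (capture c′ X)))

module CopStrategy (n : ℕ) where
  open Game (T n)
  open GameProperties (T n)

  data InBranch (i : Fin n) : Maybe (TV n) → Set where
    at-mid   : InBranch i (just (mid i))
    at-outer : InBranch i (just (outer i))

  in-branch-alive : ∀ {i r} → InBranch i r → 1 ≤ alive r
  in-branch-alive at-mid   = ≤-refl
  in-branch-alive at-outer = ≤-refl

  robber-in-branch : ∀ {m} (X : Robbers m) →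
    AllCaptured (capture centre X) ⊎ ∃[ i ] Any (InBranch i) (capture centre X)
  robber-in-branch []                   = inj₁ []
  robber-in-branch (nothing ∷ X)        = Sum.map (tt ∷_) (map₂ there) (robber-in-branch X)
  robber-in-branch (just centre ∷ X)    = Sum.map (tt ∷_) (map₂ there) (robber-in-branch X)
  robber-in-branch (just (mid i) ∷ X)   = inj₂ (i , here at-mid)
  robber-in-branch (just (outer i) ∷ X) = inj₂ (i , here at-outer)

  sweep-catches : ∀ {i r r′ r″} → InBranch i r →
    RMove (captureOne (mid i) r) r′ →
    RMove (captureOne (outer i) (captureOne (mid i) r′)) r″ → r″ ≡ nothing
  sweep-catches {i} at-mid p q =
    captured-stays-captured q
      (cong (captureOne (outer i) ∘ captureOne (mid i))
            (captured-stays-captured p (captureOne-self (mid i))))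
  sweep-catches {i} at-outer (step loop)    q = captured-stays-captured q (captureOne-self (outer i))
  sweep-catches {i} at-outer (step (o-m i)) q =
    captured-stays-captured q (cong (captureOne (outer i)) (captureOne-self (mid i)))

  sweep-remaining : ∀ {i m} {X X′ X″ : Robbers m} →
    RobberMoves (capture (mid i) X) X′ →
    RobberMoves (capture (outer i) (capture (mid i) X′)) X″ →
    Any (InBranch i) X → remaining (capture (outer i) X″) < remaining X
  sweep-remaining (p ∷ ps) (q ∷ qs) (here r∈i) with refl ← sweep-catches r∈i p q =
    +-mono-≤ (in-branch-alive r∈i) (≤-trans (remaining-round qs) (remaining-round ps))
  sweep-remaining (p ∷ ps) (q ∷ qs) (there found) =
    ≤-trans (≤-reflexive (sym (+-suc _ _)))
            (+-mono-≤ (≤-trans (alive-round q) (alive-round p)) (sweep-remaining ps qs found))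

  mutual
    wins-from-centre : ∀ s → WinsAgainst (2 + s * 4) centre (suc s)
    wins-from-centre s X bound with robber-in-branch X
    ... | inj₁ done       = inj₁ done
    ... | inj₂ (i , found) =
      inj₂ (mid i , c-m i , λ X′ p → inj₂ (outer i , m-o i , λ X″ q →
        wins-from-leaf s i X″ (≤-pred (≤-trans (sweep-remaining p q found) bound))))

    wins-from-leaf : ∀ s i → WinsAgainst (s * 4) (outer i) s
    wins-from-leaf zero    i X bound = remaining≤0⇒AllCaptured bound
    wins-from-leaf (suc s) i         = advance (o-m i) (advance (m-c i) (wins-from-centre s))

  capture-within : ∀ s → CaptureBy (suc s) (2 + s * 4)
  capture-within s = centre , λ vs →
    wins-from-centre s (map just vs)
      (≤-trans (remaining-capture centre (map just vs)) (≤-reflexive (remaining-map-just vs)))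

module LazyLeafRobbers (n : ℕ) where
  open Game (T (suc n))
  open GameProperties (T (suc n))
  open import Data.Vec.Membership.DecPropositional (≡-dec (_≟T_ {suc n})) using (_∈?_)

  data OnBranch (i : Fin (suc n)) : TV (suc n) → Set where
    centre : OnBranch i centre
    mid    : OnBranch i (mid i)
    outer  : OnBranch i (outer i)

  home : TV (suc n) → Fin (suc n)
  home centre    = Fin.zero
  home (mid i)   = i
  home (outer i) = i

  on-home : ∀ c → OnBranch (home c) c
  on-home centre    = centre
  on-home (mid i)   = mid
  on-home (outer i) = outer

  -- potential c X is the length of a shortest walk from c that visits every leaf occupied
  -- in X and ends at the centre: depth c to return, plus weight c x for each occupied leaf x.
  depth : TV (suc n) → ℕ
  depth centre    = 0
  depth (mid _)   = 1
  depth (outer _) = 2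

  weight : TV (suc n) → Fin (suc n) → ℕ
  weight centre    x = 4
  weight (mid i)   x = if does (i ≟ᶠ x) then 2 else 4
  weight (outer i) x = if does (i ≟ᶠ x) then 0 else 4

  weight-mid-own : ∀ i → weight (mid i) i ≡ 2
  weight-mid-own i rewrite dec-true (i ≟ᶠ i) refl = refl

  weight-outer-own : ∀ i → weight (outer i) i ≡ 0
  weight-outer-own i rewrite dec-true (i ≟ᶠ i) refl = refl

  weight-off-branch : ∀ {i c x} → OnBranch i c → x ≢ i → weight c x ≡ 4
  weight-off-branch                 centre _   = refl
  weight-off-branch {i} {x = x} mid    x≢i rewrite dec-false (i ≟ᶠ x) (x≢i ∘ sym) = refl
  weight-off-branch {i} {x = x} outer  x≢i rewrite dec-false (i ≟ᶠ x) (x≢i ∘ sym) = refl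

  Occupied : ∀ {m} → Fin (suc n) → Robbers m → Set
  Occupied x X = just (outer x) ∈ X

  detour : ∀ {m} → TV (suc n) → Robbers m → Fin (suc n) → ℕ
  detour c X x = if does (just (outer x) ∈? X) then weight c x else 0

  potential : ∀ {m} → TV (suc n) → Robbers m → ℕ
  potential c X = depth c + ∑[ x < suc n ] detour c X x

  detour-occupied : ∀ {m} c x {X : Robbers m} → Occupied x X → detour c X x ≡ weight c x
  detour-occupied c x {X} occ rewrite dec-true (just (outer x) ∈? X) occ = refl

  detour-unoccupied : ∀ {m} c x {X : Robbers m} → ¬ Occupied x X → detour c X x ≡ 0
  detour-unoccupied c x {X} ¬occ rewrite dec-false (just (outer x) ∈? X) ¬occ = refl

  detour-mono : ∀ {m m′} c x {X : Robbers m} {Y : Robbers m′} →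
                (Occupied x X → Occupied x Y) → detour c X x ≤ detour c Y x
  detour-mono c x {X} {Y} X⇒Y with just (outer x) ∈? X | just (outer x) ∈? Y
  ... | yes _   | yes _    = ≤-refl
  ... | yes occ | no ¬occ  = contradiction (X⇒Y occ) ¬occ
  ... | no _    | _        = z≤n

  detour-at-own-leaf : ∀ {m} x (X : Robbers m) → detour (outer x) X x ≡ 0
  detour-at-own-leaf x X with just (outer x) ∈? X
  ... | yes _ = weight-outer-own x
  ... | no _  = refl

  detour-capture : ∀ {m} c (X : Robbers m) x → detour c X x ≤ detour c (capture c X) x
  detour-capture c X x with c ≟T outer x
  ... | yes refl = ≤-trans (≤-reflexive (detour-at-own-leaf x X)) z≤n
  ... | no c≢x   = detour-mono c x λ occ →
    subst (_∈ capture c X) (captureOne-other c≢x) (∈-map⁺ (captureOne c) occ)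

  potential-end : ∀ {m} c {X : Robbers m} → AllCaptured X → potential c X ≤ 2
  potential-end c {X = X} done = begin
    depth c + ∑[ x < suc n ] detour c X x
      ≡⟨ cong (depth c +_) (sum-cong-≗ λ x → detour-unoccupied c x (captured-unoccupied done)) ⟩
    depth c + ∑[ x < suc n ] 0
      ≡⟨ cong (depth c +_) (sum-replicate-zero (suc n)) ⟩
    depth c + 0
      ≡⟨ +-identityʳ (depth c) ⟩
    depth c
      ≤⟨ depth≤2 c ⟩
    2 ∎
    where
    open ≤-Reasoning
    depth≤2 : ∀ c → depth c ≤ 2
    depth≤2 centre    = z≤n
    depth≤2 (mid _)   = s≤s z≤n
    depth≤2 (outer _) = ≤-refl

  potential-capture : ∀ {m} c (X : Robbers m) → potential c X ≤ potential c (capture c X)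
  potential-capture c X = +-monoʳ-≤ (depth c) (∑-mono-≤ (detour-capture c X))

  potential-split : ∀ {m i c} (X : Robbers m) → OnBranch i c →
    potential c X ≡ (depth c + detour c X i) + ∑[ j < n ] detour centre X (punchIn i j)
  potential-split {i = i} {c} X c∈i = begin
    depth c + ∑[ x < suc n ] detour c X x
      ≡⟨ cong (depth c +_) (sum-remove {i = i} (detour c X)) ⟩
    depth c + (detour c X i + ∑[ j < n ] detour c X (punchIn i j))
      ≡⟨ cong (λ s → depth c + (detour c X i + s)) (sum-cong-≗ off-branch) ⟩
    depth c + (detour c X i + ∑[ j < n ] detour centre X (punchIn i j))
      ≡⟨ +-assoc (depth c) _ _ ⟨
    (depth c + detour c X i) + ∑[ j < n ] detour centre X (punchIn i j) ∎
    where
    open ≡-Reasoning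
    off-branch : ∀ j → detour c X (punchIn i j) ≡ detour centre X (punchIn i j)
    off-branch j = cong (λ w → if does (just (outer (punchIn i j)) ∈? X) then w else 0)
                        (weight-off-branch c∈i (punchInᵢ≢i i j))

  own-detour-step : ∀ {m i c c′} (X : Robbers m) → TAdj c c′ → OnBranch i c → OnBranch i c′ →
    depth c + detour c X i ≤ suc (depth c′ + detour c′ X i)
  own-detour-step X loop _ _ = n≤1+n _
  own-detour-step X (c-m i) centre mid with just (outer i) ∈? X
  ... | yes _ rewrite weight-mid-own i = ≤-refl
  ... | no _  = z≤n
  own-detour-step X (m-c i) mid centre with just (outer i) ∈? X
  ... | yes _ rewrite weight-mid-own i = m≤n+m 3 2
  ... | no _  = ≤-refl
  own-detour-step X (m-o i) mid outer with just (outer i) ∈? X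
  ... | yes _ rewrite weight-mid-own i | weight-outer-own i = ≤-refl
  ... | no _  = m≤n+m 1 2
  own-detour-step X (o-m i) outer mid with just (outer i) ∈? X
  ... | yes _ rewrite weight-mid-own i | weight-outer-own i = m≤n+m 2 2
  ... | no _  = ≤-refl

  edge-on-branch : ∀ {c c′} → TAdj c c′ → ∃[ i ] OnBranch i c × OnBranch i c′
  edge-on-branch {c} loop = home c , on-home c , on-home c
  edge-on-branch (c-m i)  = i , centre , mid
  edge-on-branch (m-c i)  = i , mid , centre
  edge-on-branch (m-o i)  = i , mid , outer
  edge-on-branch (o-m i)  = i , outer , mid

  potential-move : ∀ {m c c′} (X : Robbers m) → TAdj c c′ → potential c X ≤ suc (potential c′ X)
  potential-move X e with edge-on-branch e
  ... | i , c∈i , c′∈i =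
    ≤-trans (≤-reflexive (potential-split X c∈i))
      (≤-trans (+-monoˡ-≤ _ (own-detour-step X e c∈i c′∈i))
               (≤-reflexive (cong suc (sym (potential-split X c′∈i)))))

  leaf-robbers : Fin (suc n) → Vec (TV (suc n)) n
  leaf-robbers b = tabulate (outer ∘ punchIn b)

  potential-leaf-robbers : ∀ c → n * 4 ≤ potential c (map just (leaf-robbers (home c)))
  potential-leaf-robbers c = begin
    n * 4
      ≡⟨ ∑-replicate n 4 ⟨
    ∑[ j < n ] 4
      ≡⟨ sum-cong-≗ (λ j → detour-occupied centre (punchIn b j) (occupied j)) ⟨
    ∑[ j < n ] detour centre X (punchIn b j)
      ≤⟨ m≤n+m _ _ ⟩
    (depth c + detour c X b) + ∑[ j < n ] detour centre X (punchIn b j)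
      ≡⟨ potential-split X (on-home c) ⟨
    potential c X ∎
    where
    open ≤-Reasoning
    b = home c
    X = map just (leaf-robbers b)
    occupied : ∀ j → Occupied (punchIn b j) X
    occupied j = ∈-map⁺ just (∈-tabulate⁺ (outer ∘ punchIn b) j)

  no-capture-before : ∀ t → t + 2 < n * 4 → ¬ CaptureBy n t
  no-capture-before t bound (c , strategy) =
    lazy-robbers-escape t c (capture c X)
      (≤-trans bound (≤-trans (potential-leaf-robbers c) (potential-capture c X)))
      (strategy (leaf-robbers (home c)))
    where
    open LazyRobbers potential 2 potential-end potential-capture potential-move
    X = map just (leaf-robbers (home c))

proposition3p11 : (m : ℕ) → 1 ≤ m → capt= (T (suc m)) m (4 * m ∸ 2)
proposition3p11 (suc s) _ =
  subst (capt= (T (suc (suc s))) (suc s)) (sym rounds)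
    (CopStrategy.capture-within (suc (suc s)) s , λ t t<rounds →
      LazyLeafRobbers.no-capture-before (suc s) t
        (subst (_< suc s * 4) (+-comm 2 t) (+-monoʳ-< 2 t<rounds)))
  where
  rounds : 4 * suc s ∸ 2 ≡ 2 + s * 4
  rounds = cong (_∸ 2) (*-comm 4 (suc s))
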